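{- Let $M_0$ be an $n\times n$ permutation matrix and $M_r$ the final configuration of a complete percolation sequence starting from $M_0$, whose $1$-cells form the disjoint square unitary tiles $T_1,\dots,T_m$, ordered from left to right, with $T_j$ of size $s_j$, each row and column of $M_r$ meeting exactly one $T_j$. Form the $m\times m$ matrix $CM$ by deleting from $M_r$, for each $1\le j\le m$, $s_j-1$ of the rows meeting $T_j$ and $s_j-1$ of the columns meeting $T_j$. Then $CM$ (which is an $m\times m$ permutation matrix) is no-growth, i.e. it contains no mutable cell.
   Context: Bootstrap percolation: a cell of a $0$-$1$ matrix is mutable if it contains $0$ and at least two of its orthogonal neighbours (north, south, east, west) contain $1$; a percolation step changes one mutable cell from $0$ to $1$; a percolation sequence is complete when no mutable cell remains, and its last matrix is the final configuration. A tile is a rectangular block of consecutive rows and columns; it is unitary if all its entries are $1$ and square of size $k$ if it is $k\times k$. A matrix is no-growth if it has no mutable cell. -}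

module Defs where

open import Data.Nat using (ℕ; zero; suc; _+_; _≤_; _<_; _≥_; _<?_)
open import Data.Fin using (Fin; toℕ; fromℕ<)
open import Data.Bool using (Bool; true; false)
open import Data.Product using (Σ; ∃; _×_; _,_)
open import Relation.Nullary using (¬_; yes; no)
open import Relation.Binary.PropositionalEquality using (_≡_)
open import Relation.Binary.Construct.Closure.ReflexiveTransitive using (Star)

-- An n×n 0-1 matrix: M i j is the entry in row i, column j (true = 1, false = 0).
Matrix : ℕ → Set
Matrix n = Fin n → Fin n → Bool

∃Unique : {A : Set} → (A → Set) → Set
∃Unique {A} P = Σ A λ x → P x × (∀ y → P y → y ≡ x)

IsPermutationMatrix : {n : ℕ} → Matrix n → Set
IsPermutationMatrix {n} M =
  (∀ i → ∃Unique λ j → M i j ≡ true) × (∀ j → ∃Unique λ i → M i j ≡ true)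

-- Value (0/1) of the cell at (a , b) given by natural-number coordinates;
-- cells outside the matrix count as 0.
val : {n : ℕ} → Matrix n → ℕ → ℕ → ℕ
val {n} M a b with a <? n | b <? n
... | yes a<n | yes b<n with M (fromℕ< a<n) (fromℕ< b<n)
...   | true  = 1
...   | false = 0
val M a b | _ | _ = 0

valNorth : {n : ℕ} → Matrix n → ℕ → ℕ → ℕ
valNorth M zero    b = 0
valNorth M (suc a) b = val M a b

valWest : {n : ℕ} → Matrix n → ℕ → ℕ → ℕ
valWest M a zero    = 0
valWest M a (suc b) = val M a b

onesAround : {n : ℕ} → Matrix n → Fin n → Fin n → ℕ
onesAround M i j =
  valNorth M (toℕ i) (toℕ j) + val M (suc (toℕ i)) (toℕ j)
  + val M (toℕ i) (suc (toℕ j)) + valWest M (toℕ i) (toℕ j)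

Mutable : {n : ℕ} → Matrix n → Fin n → Fin n → Set
Mutable M i j = (M i j ≡ false) × (onesAround M i j ≥ 2)

NoGrowth : {n : ℕ} → Matrix n → Set
NoGrowth M = ∀ i j → ¬ Mutable M i j

PercStep : {n : ℕ} → Matrix n → Matrix n → Set
PercStep {n} M M' = Σ (Fin n) λ i → Σ (Fin n) λ j →
  Mutable M i j × (M' i j ≡ true) ×
  (∀ i' j' → ¬ (i' ≡ i × j' ≡ j) → M' i' j' ≡ M i' j')

FinalConfiguration : {n : ℕ} → Matrix n → Matrix n → Set
FinalConfiguration M0 Mr = Star PercStep M0 Mr × NoGrowth Mr

record SquareTile (n : ℕ) : Set where
  field
    top    : ℕ
    left   : ℕ
    size   : ℕ
    size≥1 : 1 ≤ size
    fitsR  : top + size ≤ n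
    fitsC  : left + size ≤ n
open SquareTile public

RowMeets : {n : ℕ} → SquareTile n → Fin n → Set
RowMeets T i = top T ≤ toℕ i × toℕ i < top T + size T

ColMeets : {n : ℕ} → SquareTile n → Fin n → Set
ColMeets T j = left T ≤ toℕ j × toℕ j < left T + size T

InTile : {n : ℕ} → SquareTile n → Fin n → Fin n → Set
InTile T i j = RowMeets T i × ColMeets T j

TileDecomposition : {n m : ℕ} → Matrix n → (Fin m → SquareTile n) → Set
TileDecomposition {n} {m} Mr T =
  -- the 1-cells are exactly the cells of the tiles (so tiles are unitary)
  (∀ i j → (Mr i j ≡ true → ∃ λ k → InTile (T k) i j)
         × ((∃ λ k → InTile (T k) i j) → Mr i j ≡ true))
  × (∀ k k' i j → InTile (T k) i j → InTile (T k') i j → k ≡ k')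
  × (∀ k k' → toℕ k < toℕ k' → left (T k) < left (T k'))
  × (∀ i → ∃Unique λ k → RowMeets (T k) i)
  × (∀ j → ∃Unique λ k → ColMeets (T k) j)

StrictlyIncreasing : {m n : ℕ} → (Fin m → Fin n) → Set
StrictlyIncreasing f = ∀ r r' → toℕ r < toℕ r' → toℕ (f r) < toℕ (f r')

-- Rows ρ and columns γ that remain after deleting, for each tile T k,
-- (size - 1) of the rows meeting T k and (size - 1) of the columns meeting T k:
-- the kept rows/columns (listed in their original order) contain exactly one
-- row/column meeting each tile.
KeptLines : {n m : ℕ} → (Fin m → SquareTile n) → (Fin m → Fin n) → (Fin m → Fin n) → Set
KeptLines T ρ γ =
  StrictlyIncreasing ρ × StrictlyIncreasing γ
  × (∀ k → ∃Unique λ r → RowMeets (T k) (ρ r))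
  × (∀ k → ∃Unique λ c → ColMeets (T k) (γ c))

compress : {n m : ℕ} → Matrix n → (Fin m → Fin n) → (Fin m → Fin n) → Matrix m
compress Mr ρ γ r c = Mr (ρ r) (γ c)

{-# OPTIONS --safe #-}
-- Only the no-growth of Mr and its tile structure matter. The compressed matrix CM has
-- at most one 1 in each row and column, so a mutable cell of CM needs two diagonally
-- adjacent 1s. These lie in tiles A ≠ B met by consecutive kept rows and by consecutive
-- kept columns. Every line between two consecutive kept lines meets one of their two
-- tiles, so in Mr the last row (column) of A is immediately followed by a row (column)
-- of B. The cell of Mr at the corner between A and B is then a 0 with two 1-neighbours,
-- contradicting that Mr is no-growth.
module Submission where

open import Defs
open import Data.Nat using (ℕ; zero; suc; _+_; _≤_; _<_; _≤?_; _<?_; z≤n; s≤s)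
open import Data.Nat.Properties
  using (≤-refl; ≤-trans; ≤-reflexive; <⇒≤; ≰⇒>; ≮⇒≥; ≤-<-trans; <-asym; <-irrefl;
         m≤m+n; m≤n+m; +-suc; m≤n⇒m<n∨m≡n)
open import Data.Fin using (Fin; toℕ; fromℕ<)
open import Data.Fin.Properties using (toℕ-injective; toℕ<n; fromℕ<-toℕ; toℕ-fromℕ<)
open import Data.Bool using (true; false)
open import Data.Bool.Properties using (¬-not)
open import Data.Product using (∃; ∃₂; _×_; _,_; proj₁; proj₂)
open import Data.Sum using (_⊎_; inj₁; inj₂)
open import Data.Empty using (⊥-elim)
open import Relation.Nullary using (¬_; yes; no)
open import Relation.Binary.PropositionalEquality
  using (_≡_; _≢_; refl; sym; trans; cong; subst; ≢-sym)

private
  variable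
    n m : ℕ

unique-≡ : {A : Set} {P : A → Set} → ∃Unique P → ∀ {x y} → P x → P y → x ≡ y
unique-≡ (_ , _ , unique) px py = trans (unique _ px) (sym (unique _ py))

infix 4 _⋖_

_⋖_ : Fin n → Fin n → Set
i ⋖ i' = toℕ i' ≡ suc (toℕ i)

⋖⇒< : {i i' : Fin n} → i ⋖ i' → toℕ i < toℕ i'
⋖⇒< i⋖i' = ≤-reflexive (sym i⋖i')

⋖-asym : {i i' : Fin n} → i ⋖ i' → ¬ i' ⋖ i
⋖-asym i⋖i' i'⋖i = <-asym (⋖⇒< i⋖i') (⋖⇒< i'⋖i)

fromℕ<-⋖ : {a : ℕ} (a<n : a < n) (1+a<n : suc a < n) → fromℕ< a<n ⋖ fromℕ< 1+a<n
fromℕ<-⋖ a<n 1+a<n rewrite toℕ-fromℕ< a<n | toℕ-fromℕ< 1+a<n = refl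

val≤1 : (M : Matrix n) (a b : ℕ) → val M a b ≤ 1
val≤1 {n} M a b with a <? n | b <? n
... | yes a<n | yes b<n with M (fromℕ< a<n) (fromℕ< b<n)
...   | true  = ≤-refl
...   | false = z≤n
val≤1 M a b | yes _ | no _ = z≤n
val≤1 M a b | no _  | _    = z≤n

valNorth≤1 : (M : Matrix n) (a b : ℕ) → valNorth M a b ≤ 1
valNorth≤1 M zero    b = z≤n
valNorth≤1 M (suc a) b = val≤1 M a b

valWest≤1 : (M : Matrix n) (a b : ℕ) → valWest M a b ≤ 1
valWest≤1 M a zero    = z≤n
valWest≤1 M a (suc b) = val≤1 M a b

val≡1⇒true : (M : Matrix n) (a b : ℕ) → val M a b ≡ 1 →
  ∃₂ λ i j → toℕ i ≡ a × toℕ j ≡ b × M i j ≡ true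
val≡1⇒true {n} M a b val≡1 with a <? n | b <? n
... | yes a<n | yes b<n with M (fromℕ< a<n) (fromℕ< b<n) in Mab
...   | true = fromℕ< a<n , fromℕ< b<n , toℕ-fromℕ< a<n , toℕ-fromℕ< b<n , Mab
val≡1⇒true M a b () | yes _ | yes _ | false
val≡1⇒true M a b () | yes _ | no _
val≡1⇒true M a b () | no _  | _

true⇒val≡1 : (M : Matrix n) {i j : Fin n} → M i j ≡ true → val M (toℕ i) (toℕ j) ≡ 1
true⇒val≡1 {n} M {i} {j} Mij with toℕ i <? n | toℕ j <? n
... | yes i<n | yes j<n rewrite fromℕ<-toℕ i i<n | fromℕ<-toℕ j j<n | Mij = refl
... | yes _   | no j≮n = ⊥-elim (j≮n (toℕ<n j))
... | no i≮n  | _      = ⊥-elim (i≮n (toℕ<n i))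

column≡1 : (M : Matrix n) (a : ℕ) (j : Fin n) → val M a (toℕ j) ≡ 1 →
  ∃ λ i → toℕ i ≡ a × M i j ≡ true
column≡1 M a j val≡1 with val≡1⇒true M a (toℕ j) val≡1
... | i , j' , i≡a , j'≡j , Mij' rewrite toℕ-injective j'≡j = i , i≡a , Mij'

row≡1 : (M : Matrix n) (i : Fin n) (b : ℕ) → val M (toℕ i) b ≡ 1 →
  ∃ λ j → toℕ j ≡ b × M i j ≡ true
row≡1 M i b val≡1 with val≡1⇒true M (toℕ i) b val≡1
... | i' , j , i'≡i , j≡b , Mi'j rewrite toℕ-injective i'≡i = j , j≡b , Mi'j

data TwoOf (N S E W : Set) : Set where
  north-south : N → S → TwoOf N S E W
  north-east  : N → E → TwoOf N S E W
  north-west  : N → W → TwoOf N S E W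
  south-east  : S → E → TwoOf N S E W
  south-west  : S → W → TwoOf N S E W
  east-west   : E → W → TwoOf N S E W

twoOf : ∀ {w x y z} → w ≤ 1 → x ≤ 1 → y ≤ 1 → z ≤ 1 → 2 ≤ w + x + y + z →
  TwoOf (w ≡ 1) (x ≡ 1) (y ≡ 1) (z ≡ 1)
twoOf (s≤s z≤n) (s≤s z≤n) _         _         _        = north-south refl refl
twoOf (s≤s z≤n) z≤n       (s≤s z≤n) _         _        = north-east refl refl
twoOf (s≤s z≤n) z≤n       z≤n       (s≤s z≤n) _        = north-west refl refl
twoOf (s≤s z≤n) z≤n       z≤n       z≤n       (s≤s ())
twoOf z≤n       (s≤s z≤n) (s≤s z≤n) _         _        = south-east refl refl
twoOf z≤n       (s≤s z≤n) z≤n       (s≤s z≤n) _        = south-west refl refl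
twoOf z≤n       (s≤s z≤n) z≤n       z≤n       (s≤s ())
twoOf z≤n       z≤n       (s≤s z≤n) (s≤s z≤n) _        = east-west refl refl
twoOf z≤n       z≤n       (s≤s z≤n) z≤n       (s≤s ())
twoOf z≤n       z≤n       z≤n       (s≤s z≤n) (s≤s ())
twoOf z≤n       z≤n       z≤n       z≤n       ()

north≡1 : (M : Matrix n) (i j : Fin n) → valNorth M (toℕ i) (toℕ j) ≡ 1 →
  ∃ λ i₀ → i₀ ⋖ i × M i₀ j ≡ true
north≡1 M i j = north (toℕ i)
  where
  north : ∀ a → valNorth M a (toℕ j) ≡ 1 → ∃ λ i₀ → a ≡ suc (toℕ i₀) × M i₀ j ≡ true
  north (suc a) N with column≡1 M a j N
  ... | i₀ , refl , Mi₀j = i₀ , refl , Mi₀j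

south≡1 : (M : Matrix n) (i j : Fin n) → val M (suc (toℕ i)) (toℕ j) ≡ 1 →
  ∃ λ i₂ → i ⋖ i₂ × M i₂ j ≡ true
south≡1 M i j = column≡1 M (suc (toℕ i)) j

east≡1 : (M : Matrix n) (i j : Fin n) → val M (toℕ i) (suc (toℕ j)) ≡ 1 →
  ∃ λ j₂ → j ⋖ j₂ × M i j₂ ≡ true
east≡1 M i j = row≡1 M i (suc (toℕ j))

west≡1 : (M : Matrix n) (i j : Fin n) → valWest M (toℕ i) (toℕ j) ≡ 1 →
  ∃ λ j₀ → j₀ ⋖ j × M i j₀ ≡ true
west≡1 M i j = west (toℕ j)
  where
  west : ∀ b → valWest M (toℕ i) b ≡ 1 → ∃ λ j₀ → b ≡ suc (toℕ j₀) × M i j₀ ≡ true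
  west (suc b) W with row≡1 M i b W
  ... | j₀ , refl , Mij₀ = j₀ , refl , Mij₀

TwoOf-map : ∀ {N S E W N′ S′ E′ W′ : Set} →
  (N → N′) → (S → S′) → (E → E′) → (W → W′) → TwoOf N S E W → TwoOf N′ S′ E′ W′
TwoOf-map f g h k (north-south x y) = north-south (f x) (g y)
TwoOf-map f g h k (north-east x y)  = north-east (f x) (h y)
TwoOf-map f g h k (north-west x y)  = north-west (f x) (k y)
TwoOf-map f g h k (south-east x y)  = south-east (g x) (h y)
TwoOf-map f g h k (south-west x y)  = south-west (g x) (k y)
TwoOf-map f g h k (east-west x y)   = east-west (h x) (k y)

mutable⇒twoOnesAround : (M : Matrix n) {i j : Fin n} → Mutable M i j →
  TwoOf (∃ λ i₀ → i₀ ⋖ i × M i₀ j ≡ true) (∃ λ i₂ → i ⋖ i₂ × M i₂ j ≡ true)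
        (∃ λ j₂ → j ⋖ j₂ × M i j₂ ≡ true) (∃ λ j₀ → j₀ ⋖ j × M i j₀ ≡ true)
mutable⇒twoOnesAround M {i} {j} (_ , ≥2) =
  TwoOf-map (north≡1 M i j) (south≡1 M i j) (east≡1 M i j) (west≡1 M i j)
    (twoOf (valNorth≤1 M (toℕ i) (toℕ j)) (val≤1 M (suc (toℕ i)) (toℕ j))
           (val≤1 M (toℕ i) (suc (toℕ j))) (valWest≤1 M (toℕ i) (toℕ j)) ≥2)

IsPartialPermutation : Matrix n → Set
IsPartialPermutation M =
  (∀ {i j j'} → M i j ≡ true → M i j' ≡ true → j ≡ j') ×
  (∀ {i i' j} → M i j ≡ true → M i' j ≡ true → i ≡ i')

NoDiagonallyAdjacentOnes : Matrix n → Set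
NoDiagonallyAdjacentOnes M = ∀ {i i' j j'} → i ⋖ i' → j ⋖ j' →
  ¬ (M i j ≡ true × M i' j' ≡ true) × ¬ (M i j' ≡ true × M i' j ≡ true)

partialPermutation⇒noGrowth : (M : Matrix n) → IsPartialPermutation M →
  NoDiagonallyAdjacentOnes M → NoGrowth M
partialPermutation⇒noGrowth M (row-unique , column-unique) noDiagonal i j mutable
  with mutable⇒twoOnesAround M mutable
... | north-south (i₀ , i₀⋖i , N) (i₂ , i⋖i₂ , S) =
  ⋖-asym i₀⋖i (subst (i ⋖_) (sym (column-unique N S)) i⋖i₂)
... | north-east (i₀ , i₀⋖i , N) (j₂ , j⋖j₂ , E) = proj₁ (noDiagonal i₀⋖i j⋖j₂) (N , E)
... | north-west (i₀ , i₀⋖i , N) (j₀ , j₀⋖j , W) = proj₂ (noDiagonal i₀⋖i j₀⋖j) (N , W)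
... | south-east (i₂ , i⋖i₂ , S) (j₂ , j⋖j₂ , E) = proj₂ (noDiagonal i⋖i₂ j⋖j₂) (E , S)
... | south-west (i₂ , i⋖i₂ , S) (j₀ , j₀⋖j , W) = proj₁ (noDiagonal i⋖i₂ j₀⋖j) (W , S)
... | east-west (j₂ , j⋖j₂ , E) (j₀ , j₀⋖j , W) =
  ⋖-asym j₀⋖j (subst (j ⋖_) (row-unique E W) j⋖j₂)

mutable-north-east : (M : Matrix n) {i i' j j' : Fin n} → i ⋖ i' → j ⋖ j' →
  M i j ≡ true → M i' j' ≡ true → M i' j ≢ true → Mutable M i' j
mutable-north-east M {i} {i'} {j} {j'} i⋖i' j⋖j' N E empty =
  ¬-not empty , two-of-north-east N≡1 E≡1
  where
  N≡1 : valNorth M (toℕ i') (toℕ j) ≡ 1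
  N≡1 rewrite i⋖i' = true⇒val≡1 M N
  E≡1 : val M (toℕ i') (suc (toℕ j)) ≡ 1
  E≡1 = subst (λ b → val M (toℕ i') b ≡ 1) j⋖j' (true⇒val≡1 M E)
  two-of-north-east : ∀ {w x y z} → w ≡ 1 → y ≡ 1 → 2 ≤ w + x + y + z
  two-of-north-east {x = x} {z = z} refl refl = s≤s (≤-trans (m≤n+m 1 x) (m≤m+n (x + 1) z))

mutable-north-west : (M : Matrix n) {i i' j j' : Fin n} → i ⋖ i' → j ⋖ j' →
  M i j' ≡ true → M i' j ≡ true → M i' j' ≢ true → Mutable M i' j'
mutable-north-west M {i} {i'} {j} {j'} i⋖i' j⋖j' N W empty =
  ¬-not empty , two-of-north-west N≡1 W≡1
  where
  N≡1 : valNorth M (toℕ i') (toℕ j') ≡ 1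
  N≡1 rewrite i⋖i' = true⇒val≡1 M N
  W≡1 : valWest M (toℕ i') (toℕ j') ≡ 1
  W≡1 rewrite j⋖j' = true⇒val≡1 M W
  two-of-north-west : ∀ {w x y z} → w ≡ 1 → z ≡ 1 → 2 ≤ w + x + y + z
  two-of-north-west {x = x} {y = y} refl refl = s≤s (m≤n+m 1 (x + y))

InInterval : ℕ → ℕ → ℕ → Set
InInterval lo s x = lo ≤ x × x < lo + s

module IntervalPartition (lo sz : Fin m → ℕ) (sz≥1 : ∀ k → 1 ≤ sz k)
  (partition : (i : Fin n) → ∃Unique λ k → InInterval (lo k) (sz k) (toℕ i)) where

  infix 4 _∈_

  _∈_ : Fin n → Fin m → Set
  i ∈ k = InInterval (lo k) (sz k) (toℕ i)

  ∈-unique : ∀ {i k k'} → i ∈ k → i ∈ k' → k ≡ k'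
  ∈-unique {i} = unique-≡ (partition i)

  ∈-convex : ∀ {k x y z} → x ∈ k → z ∈ k → toℕ x ≤ toℕ y → toℕ y ≤ toℕ z → y ∈ k
  ∈-convex (lo≤x , _) (_ , z<end) x≤y y≤z = ≤-trans lo≤x x≤y , ≤-<-trans y≤z z<end

  end∉ : ∀ {k x} → toℕ x ≡ lo k + sz k → ¬ x ∈ k
  end∉ x≡end (_ , x<end) = <-irrefl x≡end x<end

  end≤ : ∀ {k x y} → x ∈ k → toℕ x ≤ toℕ y → ¬ y ∈ k → lo k + sz k ≤ toℕ y
  end≤ (lo≤x , _) x≤y y∉k = ≮⇒≥ λ y<end → y∉k (≤-trans lo≤x x≤y , y<end)

  last : ∀ k → ∃ λ a → lo k ≤ a × lo k + sz k ≡ suc a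
  last k with sz k | sz≥1 k
  ... | suc s | _ = lo k + s , m≤m+n (lo k) s , +-suc (lo k) s

  module Transversal (ρ : Fin m → Fin n) (ρ-increasing : StrictlyIncreasing ρ)
    (ρ-hits : ∀ k → ∃Unique λ r → ρ r ∈ k) where

    hit-unique : ∀ {k r r'} → ρ r ∈ k → ρ r' ∈ k → r ≡ r'
    hit-unique {k} = unique-≡ (ρ-hits k)

    ρ-mono : ∀ {r r'} → toℕ r ≤ toℕ r' → toℕ (ρ r) ≤ toℕ (ρ r')
    ρ-mono {r} {r'} r≤r' with m≤n⇒m<n∨m≡n r≤r'
    ... | inj₁ r<r' = <⇒≤ (ρ-increasing r r' r<r')
    ... | inj₂ r≡r' rewrite toℕ-injective r≡r' = ≤-refl

    consecutive-distinct : ∀ {r r' A B} → r ⋖ r' → ρ r ∈ A → ρ r' ∈ B → A ≢ B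
    consecutive-distinct r⋖r' ρr∈A ρr'∈A refl =
      <-irrefl (cong toℕ (hit-unique ρr∈A ρr'∈A)) (⋖⇒< r⋖r')

    between-consecutive : ∀ {r r' A B x} → r ⋖ r' → ρ r ∈ A → ρ r' ∈ B →
      toℕ (ρ r) ≤ toℕ x → toℕ x ≤ toℕ (ρ r') → x ∈ A ⊎ x ∈ B
    between-consecutive {r} {r'} {x = x} r⋖r' ρr∈A ρr'∈B ρr≤x x≤ρr'
      with partition x
    ... | C , x∈C , _ with ρ-hits C
    ... | r'' , ρr''∈C , _ with toℕ r'' ≤? toℕ r
    ... | yes r''≤r =
      inj₁ (subst (x ∈_) (∈-unique (∈-convex ρr''∈C x∈C (ρ-mono r''≤r) ρr≤x) ρr∈A) x∈C)
    ... | no r''≰r =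
      inj₂ (subst (x ∈_) (∈-unique (∈-convex x∈C ρr''∈C x≤ρr' (ρ-mono r'≤r'')) ρr'∈B) x∈C)
      where
      r'≤r'' : toℕ r' ≤ toℕ r''
      r'≤r'' = subst (_≤ toℕ r'') (sym r⋖r') (≰⇒> r''≰r)

    consecutive-adjacent : ∀ {r r' A B} → r ⋖ r' → ρ r ∈ A → ρ r' ∈ B →
      ∃₂ λ i i' → i ⋖ i' × i ∈ A × i' ∈ B
    consecutive-adjacent {r} {r'} {A} {B} r⋖r' ρr∈A ρr'∈B with last A
    ... | a , lo≤a , end≡1+a = i , i' , fromℕ<-⋖ a<n 1+a<n , i∈A , i'∈B
      where
      end≤ρr' : lo A + sz A ≤ toℕ (ρ r')
      end≤ρr' = end≤ ρr∈A (ρ-mono (<⇒≤ (⋖⇒< r⋖r')))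
                  (λ ρr'∈A → consecutive-distinct r⋖r' ρr∈A ρr'∈A refl)
      1+a<n : suc a < n
      1+a<n = ≤-<-trans (subst (_≤ toℕ (ρ r')) end≡1+a end≤ρr') (toℕ<n (ρ r'))
      a<n : a < n
      a<n = <⇒≤ 1+a<n
      i  = fromℕ< a<n
      i' = fromℕ< 1+a<n
      i∈A : i ∈ A
      i∈A rewrite toℕ-fromℕ< a<n | end≡1+a = lo≤a , ≤-refl
      i'≡end : toℕ i' ≡ lo A + sz A
      i'≡end = trans (toℕ-fromℕ< 1+a<n) (sym end≡1+a)
      i'∈B : i' ∈ B
      i'∈B with between-consecutive r⋖r' ρr∈A ρr'∈B
                  (subst (toℕ (ρ r) ≤_) (sym i'≡end) (<⇒≤ (proj₂ ρr∈A)))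
                  (subst (_≤ toℕ (ρ r')) (sym i'≡end) end≤ρr')
      ... | inj₁ i'∈A = ⊥-elim (end∉ i'≡end i'∈A)
      ... | inj₂ i'∈B = i'∈B

module Compression (Mr : Matrix n) (T : Fin m → SquareTile n) (ρ γ : Fin m → Fin n)
  (one⇒tile : ∀ {i j} → Mr i j ≡ true → ∃ λ k → InTile (T k) i j)
  (tile⇒one : ∀ {i j k} → InTile (T k) i j → Mr i j ≡ true)
  (row-partition : ∀ i → ∃Unique λ k → RowMeets (T k) i)
  (column-partition : ∀ j → ∃Unique λ k → ColMeets (T k) j)
  (ρ-increasing : StrictlyIncreasing ρ) (γ-increasing : StrictlyIncreasing γ)
  (ρ-hits : ∀ k → ∃Unique λ r → RowMeets (T k) (ρ r))
  (γ-hits : ∀ k → ∃Unique λ c → ColMeets (T k) (γ c))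
  (Mr-noGrowth : NoGrowth Mr) where

  module Rows = IntervalPartition (λ k → top (T k)) (λ k → size (T k)) (λ k → size≥1 (T k))
                  row-partition
  module Columns = IntervalPartition (λ k → left (T k)) (λ k → size (T k)) (λ k → size≥1 (T k))
                     column-partition
  module KeptRows = Rows.Transversal ρ ρ-increasing ρ-hits
  module KeptColumns = Columns.Transversal γ γ-increasing γ-hits

  CM : Matrix m
  CM = compress Mr ρ γ

  off-tiles : ∀ {i j A B} → RowMeets (T A) i → ColMeets (T B) j → A ≢ B → Mr i j ≢ true
  off-tiles i∈A j∈B A≢B Mij with one⇒tile Mij
  ... | C , i∈C , j∈C = A≢B (trans (Rows.∈-unique i∈A i∈C) (Columns.∈-unique j∈C j∈B))

  compress-isPartialPermutation : IsPartialPermutation CM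
  compress-isPartialPermutation = row-unique , column-unique
    where
    row-unique : ∀ {r c c'} → CM r c ≡ true → CM r c' ≡ true → c ≡ c'
    row-unique CMrc CMrc' with one⇒tile CMrc | one⇒tile CMrc'
    ... | A , ρr∈A , γc∈A | B , ρr∈B , γc'∈B with Rows.∈-unique ρr∈A ρr∈B
    ... | refl = KeptColumns.hit-unique γc∈A γc'∈B
    column-unique : ∀ {r r' c} → CM r c ≡ true → CM r' c ≡ true → r ≡ r'
    column-unique CMrc CMr'c with one⇒tile CMrc | one⇒tile CMr'c
    ... | A , ρr∈A , γc∈A | B , ρr'∈B , γc∈B with Columns.∈-unique γc∈A γc∈B
    ... | refl = KeptRows.hit-unique ρr∈A ρr'∈B

  no-diagonal : ∀ {r r' c c'} → r ⋖ r' → c ⋖ c' → ¬ (CM r c ≡ true × CM r' c' ≡ true)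
  no-diagonal r⋖r' c⋖c' (CMrc , CMr'c') with one⇒tile CMrc | one⇒tile CMr'c'
  ... | A , ρr∈A , γc∈A | B , ρr'∈B , γc'∈B
    with KeptRows.consecutive-adjacent r⋖r' ρr∈A ρr'∈B
       | KeptColumns.consecutive-adjacent c⋖c' γc∈A γc'∈B
  ... | i , i' , i⋖i' , i∈A , i'∈B | j , j' , j⋖j' , j∈A , j'∈B =
    Mr-noGrowth i' j (mutable-north-east Mr i⋖i' j⋖j'
      (tile⇒one (i∈A , j∈A)) (tile⇒one (i'∈B , j'∈B)) (off-tiles i'∈B j∈A B≢A))
    where
    B≢A : B ≢ A
    B≢A = ≢-sym (KeptRows.consecutive-distinct r⋖r' ρr∈A ρr'∈B)

  no-antidiagonal : ∀ {r r' c c'} → r ⋖ r' → c ⋖ c' → ¬ (CM r c' ≡ true × CM r' c ≡ true)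
  no-antidiagonal r⋖r' c⋖c' (CMrc' , CMr'c) with one⇒tile CMrc' | one⇒tile CMr'c
  ... | A , ρr∈A , γc'∈A | B , ρr'∈B , γc∈B
    with KeptRows.consecutive-adjacent r⋖r' ρr∈A ρr'∈B
       | KeptColumns.consecutive-adjacent c⋖c' γc∈B γc'∈A
  ... | i , i' , i⋖i' , i∈A , i'∈B | j , j' , j⋖j' , j∈B , j'∈A =
    Mr-noGrowth i' j' (mutable-north-west Mr i⋖i' j⋖j'
      (tile⇒one (i∈A , j'∈A)) (tile⇒one (i'∈B , j∈B)) (off-tiles i'∈B j'∈A B≢A))
    where
    B≢A : B ≢ A
    B≢A = ≢-sym (KeptRows.consecutive-distinct r⋖r' ρr∈A ρr'∈B)

  compress-noDiagonallyAdjacentOnes : NoDiagonallyAdjacentOnes CM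
  compress-noDiagonallyAdjacentOnes r⋖r' c⋖c' =
    no-diagonal r⋖r' c⋖c' , no-antidiagonal r⋖r' c⋖c'

corollary2p12 : (n m : ℕ) (M0 Mr : Matrix n) (T : Fin m → SquareTile n)
    (ρ γ : Fin m → Fin n) →
    IsPermutationMatrix M0 →
    FinalConfiguration M0 Mr →
    TileDecomposition Mr T →
    KeptLines T ρ γ →
    NoGrowth (compress Mr ρ γ)
corollary2p12 n m M0 Mr T ρ γ _ (_ , Mr-noGrowth)
  (cells , _ , _ , row-partition , column-partition)
  (ρ-increasing , γ-increasing , ρ-hits , γ-hits) =
  partialPermutation⇒noGrowth CM compress-isPartialPermutation compress-noDiagonallyAdjacentOnes
  where
  open Compression Mr T ρ γ
    (λ {i} {j} → proj₁ (cells i j)) (λ {i} {j} {k} t → proj₂ (cells i j) (k , t))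
    row-partition column-partition ρ-increasing γ-increasing ρ-hits γ-hits Mr-noGrowth
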